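{- Let $A=\{a_s(n_s)\}_{s=1}^k$ (with $a_s\in\mathbb Z$, $n_s\in\mathbb Z^+$) be an $m$-cover of $\mathbb Z$, let $m_1,\ldots,m_k\in\mathbb Z$ and $J\subseteq\{1,\ldots,k\}$. Then $$\Big|\Big\{\sum_{s\in I}\frac{a_sm_s}{n_s}-\frac{|I|}{2}:\ I\subseteq\{1,\ldots,k\}\ \text{and}\ \sum_{s\in I}\frac{m_s}{n_s}-\sum_{s\in J}\frac{m_s}{n_s}\in\mathbb Z\Big\}\Big|>m.$$
   Context: For $a\in\mathbb Z$ and $n\in\mathbb Z^+$, $a(n)=a+n\mathbb Z$. For $A=\{a_s(n_s)\}_{s=1}^k$, $w_A(x)=|\{1\le s\le k: x\in a_s(n_s)\}|$; $A$ is an $m$-cover of $\mathbb Z$ if $w_A(x)\ge m$ for all $x\in\mathbb Z$. -}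

module Defs where

open import Data.Nat as ℕ using (ℕ; zero; suc; _≤_)
open import Data.Integer as ℤ using (ℤ; +_)
open import Data.Integer.Divisibility as ℤD using ()
open import Data.Nat.Divisibility as ℕD using ()
open import Data.Rational as ℚ using (ℚ; 0ℚ; _/_)
open import Data.Fin using (Fin)
open import Data.Fin.Subset using (Subset; _∈_; ∣_∣)
open import Data.Fin.Subset.Properties using (_∈?_)
open import Data.List using (List; filter; length; foldr)
open import Data.List.Base using (allFin)
open import Relation.Binary.PropositionalEquality using (_≡_)
open import Data.Product using (∃)
open import Relation.Nullary using (Dec)

_∈RC_,_ : ℤ → ℤ → ℕ → Set
x ∈RC a , n = (+ n) ℤD.∣ (x ℤ.- a)

_∈RC?_,_ : (x a : ℤ) (n : ℕ) → Dec (x ∈RC a , n)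
x ∈RC? a , n = n ℕD.∣? ℤ.∣ x ℤ.- a ∣

w : ∀ {k} → (Fin k → ℤ) → (Fin k → ℕ) → ℤ → ℕ
w {k} a n x = length (filter (λ s → x ∈RC? a s , n s) (allFin k))

IsMCover : ∀ {k} → ℕ → (Fin k → ℤ) → (Fin k → ℕ) → Set
IsMCover m a n = ∀ (x : ℤ) → m ≤ w a n x

-- the rational number p / q  (q is always positive where used; 0 for q = 0 by convention)
frac : ℤ → ℕ → ℚ
frac p zero = 0ℚ
frac p (suc q) = p / suc q

sumOver : ∀ {k} → Subset k → (Fin k → ℚ) → ℚ
sumOver {k} I f = foldr (λ s acc → f s ℚ.+ acc) 0ℚ (filter (λ s → s ∈? I) (allFin k))

IsInt : ℚ → Set
IsInt q = ∃ λ (z : ℤ) → q ≡ z / 1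

value : ∀ {k} → (Fin k → ℤ) → (Fin k → ℕ) → (Fin k → ℤ) → Subset k → ℚ
value a n ms I = sumOver I (λ s → frac (a s ℤ.* ms s) (n s)) ℚ.- ((+ ∣ I ∣) / 2)

Admissible : ∀ {k} → (Fin k → ℕ) → (Fin k → ℤ) → Subset k → Subset k → Set
Admissible n ms J I = IsInt (sumOver I (λ s → frac (ms s) (n s)) ℚ.- sumOver J (λ s → frac (ms s) (n s)))

-- Put M = 2 ∏ n_s and μ_s = m_s M / n_s ∈ ℤ. The values in question are e(I) / M with
-- e(I) = ∑_{s∈I} (a_s μ_s − M/2), and I is admissible iff M divides ∑_{s∈J} μ_s − ∑_{s∈I} μ_s.
-- Sun's argument uses the character t ↦ exp(2πit/M), but only through four properties: period M,
-- vanishing sums along the progressions t + x j (x < M) when M ∤ j, χ(t + M/2) = −χ(t), and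
-- χ(0) ≠ 0. An integer-valued χ with these properties is obtained from the indicator of Mℤ by
-- differencing with step M/q for every prime q ∣ M. The orthogonality relation turns the
-- admissibility condition into an average of χ along a progression; if |T| < m, the m-cover
-- property gives for every point x of the progression some s ∉ T with M ∣ (a_s − x) μ_s, so the
-- alternating sum ∑_{I ⊇ T admissible} (−1)^{|I|} χ(t + ∑_{s∈I} a_s μ_s) vanishes. Multiplying its
-- terms by a polynomial in e(I) of degree d < m − |T| keeps the sum zero. If there were at most
-- m admissible values, the product of e − b over those b ≠ e(J) would, at t = −e(J), leave a
-- positive multiple of χ(0) ∏ (e(J) − b) ≠ 0.

module Submission where

open import Defs
open import Data.Nat as ℕ using (ℕ; zero; suc; _<_; _≤_; NonZero)
import Data.Nat.Properties as ℕP
import Data.Nat.Divisibility as ℕD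
open import Data.Nat.GCD using (module Bézout; module GCD)
open import Data.Nat.Primality using (Prime; prime?; euclidsLemma; prime⇒irreducible; ¬prime[1]; prime⇒nonZero; prime[2])
open import Data.Nat.Primality.Factorisation using (factorise)
open import Data.Nat.ListAction using (product)
open import Data.Nat.ListAction.Properties using (∈⇒∣product; product≢0)
open import Data.Integer as ℤ using (ℤ; +_; -[1+_]; _+_; _*_; _-_; -_; 0ℤ; 1ℤ)
import Data.Integer.Properties as ℤP
open import Data.Integer.Divisibility.Signed
  using (_∣_; divides; _∣?_; ∣-refl; ∣m∣n⇒∣m+n; ∣m+n∣n⇒∣m; ∣m⇒∣-m; ∣m⇒∣m*n; ∣ᵤ⇒∣)
open import Data.Integer.Tactic.RingSolver using (solve-∀)
open import Algebra.Properties.AbelianGroup ℤP.+-0-abelianGroup using () renaming (∙-cancelʳ to +-cancelʳ)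
open import Algebra.Properties.CommutativeSemigroup ℤP.+-commutativeSemigroup using () renaming (interchange to +-interchange)
open import Data.Rational as ℚ using (ℚ; 0ℚ; _/_; toℚᵘ)
import Data.Rational.Properties as ℚP
open import Data.Rational.Unnormalised as ℚᵘ using (ℚᵘ; mkℚᵘ; _≃_; *≡*)
import Data.Rational.Unnormalised.Properties as ℚᵘP
open import Data.Fin as Fin using (Fin; zero; suc)
import Data.Fin.Properties as FinP
open import Data.Vec using ([]; _∷_; lookup; _[_]≔_)
open import Data.Fin.Subset using (Subset; ∣_∣; inside; outside; ⊥; ⊤)
open import Data.Fin.Subset.Properties using (_∈?_; ∣⊥∣≡0)
open import Data.List as List using (List; []; _∷_; length; map; filter; foldr; tabulate; allFin; _++_; deduplicate)
import Data.List.Properties as LP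
import Data.List.Relation.Unary.All as All
open All using (All; []; _∷_)
open import Data.List.Relation.Unary.All.Properties using (all-filter; tabulate⁺)
open import Data.List.Relation.Unary.AllPairs using (AllPairs; []; _∷_)
import Data.List.Relation.Unary.Any as Any
open Any using (here; there)
open import Data.List.Relation.Unary.Unique.Propositional using (Unique)
open import Data.List.Relation.Unary.Unique.DecPropositional.Properties ℤ._≟_ using (deduplicate-!)
open import Data.List.Membership.Propositional using (_∈_)
open import Data.List.Membership.Propositional.Properties
  using ( ∈-map⁺; ∈-map⁻; ∈-filter⁺; ∈-filter⁻; ∈-deduplicate⁺; ∈-deduplicate⁻
        ; ∈-lookup; ∈-tabulate⁺; ∈-++⁺ˡ; ∈-++⁺ʳ)
open import Data.Product as Product using (∃; ∃₂; _×_; _,_; proj₁; proj₂)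
open import Data.Sum using (_⊎_; inj₁; inj₂)
open import Data.Empty using (⊥-elim) renaming (⊥ to Empty)
open import Function using (_∘_)
open import Function.Definitions using (Injective)
open import Relation.Binary.PropositionalEquality
open import Relation.Nullary using (Dec; yes; no; ¬_; ¬?)
open import Relation.Nullary.Decidable using (_×-dec_)

-- Sums over ranges and periodic functions

∑< : ℕ → (ℕ → ℤ) → ℤ
∑< zero    f = 0ℤ
∑< (suc n) f = ∑< n f + f n

∑<-cong : ∀ n {f g : ℕ → ℤ} → (∀ x → f x ≡ g x) → ∑< n f ≡ ∑< n g
∑<-cong zero    f≗g = refl
∑<-cong (suc n) f≗g = cong₂ _+_ (∑<-cong n f≗g) (f≗g n)

∑<-distrib-minus : ∀ n (f g : ℕ → ℤ) → ∑< n (λ x → f x - g x) ≡ ∑< n f - ∑< n g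
∑<-distrib-minus zero    f g = refl
∑<-distrib-minus (suc n) f g = trans (cong (_+ (f n - g n)) (∑<-distrib-minus n f g)) (lem (∑< n f) (∑< n g) (f n) (g n))
  where lem : ∀ a b c d → a - b + (c - d) ≡ a + c - (b + d)
        lem = solve-∀

∑<-const : ∀ n c → ∑< n (λ _ → c) ≡ + n * c
∑<-const zero    c = refl
∑<-const (suc n) c = trans (cong (_+ c) (∑<-const n c)) (lem (+ n) c)
  where lem : ∀ a c → a * c + c ≡ (1ℤ + a) * c
        lem = solve-∀

∑<-*ˡ : ∀ n c (f : ℕ → ℤ) → ∑< n (λ x → c * f x) ≡ c * ∑< n f
∑<-*ˡ zero    c f = sym (ℤP.*-zeroʳ c)
∑<-*ˡ (suc n) c f = trans (cong (_+ c * f n) (∑<-*ˡ n c f)) (sym (ℤP.*-distribˡ-+ c (∑< n f) (f n)))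

∑<-zero : ∀ n {f : ℕ → ℤ} → (∀ x → f x ≡ 0ℤ) → ∑< n f ≡ 0ℤ
∑<-zero n f≗0 = trans (∑<-cong n f≗0) (trans (∑<-const n 0ℤ) (ℤP.*-zeroʳ (+ n)))

∑<-rotate : ∀ (F : ℤ → ℤ) n → ∑< n (λ x → F (+ suc x)) + F 0ℤ ≡ ∑< n (λ x → F (+ x)) + F (+ n)
∑<-rotate F zero    = refl
∑<-rotate F (suc n) = begin
    ∑< n (λ x → F (+ suc x)) + F (+ suc n) + F 0ℤ   ≡⟨ lem (∑< n (λ x → F (+ suc x))) (F (+ suc n)) (F 0ℤ) ⟩
    ∑< n (λ x → F (+ suc x)) + F 0ℤ + F (+ suc n)   ≡⟨ cong (_+ F (+ suc n)) (∑<-rotate F n) ⟩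
    ∑< n (λ x → F (+ x)) + F (+ n) + F (+ suc n)     ∎
  where open ≡-Reasoning
        lem : ∀ a b c → a + b + c ≡ a + c + b
        lem = solve-∀

module Periodicity (M : ℕ) where

  Periodic : (ℤ → ℤ) → Set
  Periodic F = ∀ y → F (y + + M) ≡ F y

  periodic-translate : ∀ {F} → Periodic F → ∀ c → Periodic (λ y → F (y + c))
  periodic-translate {F} per c y = trans (cong F (lem y (+ M) c)) (per (y + c))
    where lem : ∀ a b c → a + b + c ≡ a + c + b
          lem = solve-∀

  private
    periodic-+*ℕ : ∀ {F} → Periodic F → ∀ y n → F (y + + n * + M) ≡ F y
    periodic-+*ℕ {F} per y zero    = cong F (ℤP.+-identityʳ y)
    periodic-+*ℕ {F} per y (suc n) =
      trans (cong F (lem y (+ n) (+ M))) (trans (per (y + + n * + M)) (periodic-+*ℕ per y n))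
      where lem : ∀ a b c → a + (1ℤ + b) * c ≡ a + b * c + c
            lem = solve-∀

  periodic-+* : ∀ {F} → Periodic F → ∀ y z → F (y + z * + M) ≡ F y
  periodic-+* per y (+ n)      = periodic-+*ℕ per y n
  periodic-+* {F} per y -[1+ n ] =
    sym (trans (cong F (sym (lem y (+ suc n) (+ M)))) (periodic-+*ℕ per (y + -[1+ n ] * + M) (suc n)))
    where lem : ∀ a b c → a + - b * c + b * c ≡ a
          lem = solve-∀

  private
    ∑<-translate-pos : ∀ {F} → Periodic F → ∀ s → ∑< M (λ x → F (+ x + + s)) ≡ ∑< M (λ x → F (+ x))
    ∑<-translate-pos {F} per zero    = ∑<-cong M (λ x → cong F (ℤP.+-identityʳ (+ x)))
    ∑<-translate-pos {F} per (suc s) = begin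
        ∑< M (λ x → F (+ x + + suc s))   ≡⟨ ∑<-cong M (λ x → cong F (cong +_ (ℕP.+-suc x s))) ⟩
        ∑< M (λ x → G (+ suc x))         ≡⟨ +-cancelʳ (G 0ℤ) _ _ rotated ⟩
        ∑< M (λ x → G (+ x))             ≡⟨ ∑<-translate-pos per s ⟩
        ∑< M (λ x → F (+ x))             ∎
      where
      open ≡-Reasoning
      G : ℤ → ℤ
      G y = F (y + + s)
      rotated : ∑< M (λ x → G (+ suc x)) + G 0ℤ ≡ ∑< M (λ x → G (+ x)) + G 0ℤ
      rotated = trans (∑<-rotate G M) (cong (λ w → ∑< M (λ x → G (+ x)) + w) (periodic-translate per (+ s) 0ℤ))

  ∑<-translate : ∀ {F} → Periodic F → ∀ c → ∑< M (λ x → F (+ x + c)) ≡ ∑< M (λ x → F (+ x))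
  ∑<-translate per (+ s)    = ∑<-translate-pos per s
  ∑<-translate {F} per -[1+ s ] = begin
      ∑< M (λ x → G (+ x))               ≡⟨ sym (∑<-translate-pos (periodic-translate per -[1+ s ]) (suc s)) ⟩
      ∑< M (λ x → G (+ x + + suc s))     ≡⟨ ∑<-cong M (λ x → cong F (lem (+ x) (+ suc s))) ⟩
      ∑< M (λ x → F (+ x))               ∎
    where
    open ≡-Reasoning
    G : ℤ → ℤ
    G y = F (y + -[1+ s ])
    lem : ∀ a b → a + b + - b ≡ a
    lem = solve-∀

-- An integer-valued stand-in for t ↦ exp(2πit/M), with half in the role of M/2

record Character (M : ℕ) (half : ℤ) : Set where
  field
    χ               : ℤ → ℤ
    periodic        : Periodicity.Periodic M χ
    progression-∑≡0 : ∀ {j} → ¬ (+ M ∣ j) → ∀ s → ∑< M (λ x → χ (s + + x * j)) ≡ 0ℤ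
    antiperiodic    : ∀ t → χ (t + half) ≡ - χ t
    χ-0≢0           : χ 0ℤ ≢ 0ℤ

indicator : {P : Set} → Dec P → ℤ
indicator (yes _) = 1ℤ
indicator (no _)  = 0ℤ

indicator-yes : {P : Set} (P? : Dec P) → P → indicator P? ≡ 1ℤ
indicator-yes (yes _) _ = refl
indicator-yes (no ¬p) p = ⊥-elim (¬p p)

indicator-no : {P : Set} (P? : Dec P) → ¬ P → indicator P? ≡ 0ℤ
indicator-no (yes p) ¬p = ⊥-elim (¬p p)
indicator-no (no _)  _  = refl

private
  pos-+-* : ∀ g y b → + (g ℕ.+ y ℕ.* b) ≡ + g + + y * + b
  pos-+-* g y b = trans (ℤP.pos-+ g (y ℕ.* b)) (cong (ℤ._+_ (+ g)) (ℤP.pos-* y b))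

  i+j≡k⇒i≡k-j : ∀ {i j k} → i + j ≡ k → i ≡ k - j
  i+j≡k⇒i≡k-j {i} {j} eq = trans (lem i j) (cong (_- j) eq)
    where lem : ∀ i j → i ≡ i + j - j
          lem = solve-∀

bézout-ℤ : ∀ {g a b} → Bézout.Identity g a b → ∃₂ λ X Y → + g ≡ X * + a + Y * + b
bézout-ℤ {g} {a} {b} (Bézout.+- x y g+yb≡xa) =
  + x , - + y , trans (i+j≡k⇒i≡k-j (trans (sym (pos-+-* g y b)) (trans (cong +_ g+yb≡xa) (ℤP.pos-* x a))))
                      (lem (+ x * + a) (+ y) (+ b))
  where lem : ∀ u y b → u - y * b ≡ u + - y * b
        lem = solve-∀
bézout-ℤ {g} {a} {b} (Bézout.-+ x y g+xa≡yb) =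
  - + x , + y , trans (i+j≡k⇒i≡k-j (trans (sym (pos-+-* g x a)) (trans (cong +_ g+xa≡yb) (ℤP.pos-* y b))))
                      (lem (+ y * + b) (+ x) (+ a))
  where lem : ∀ w x a → w - x * a ≡ - x * a + w
        lem = solve-∀

module DifferencedIndicator (M : ℕ) where

  open Periodicity M

  δ : ℤ → ℤ
  δ t = indicator (+ M ∣? t)

  δ-periodic : Periodic δ
  δ-periodic y with + M ∣? y
  ... | yes M∣y = indicator-yes (+ M ∣? (y + + M)) (∣m∣n⇒∣m+n M∣y ∣-refl)
  ... | no  M∤y = indicator-no  (+ M ∣? (y + + M)) (λ M∣y+M → M∤y (∣m+n∣n⇒∣m M∣y+M ∣-refl))

  ψ : List ℕ → ℤ → ℤ
  ψ []       t = δ t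
  ψ (d ∷ ds) t = ψ ds (t - + d) - ψ ds t

  ψ-periodic : ∀ ds → Periodic (ψ ds)
  ψ-periodic []       = δ-periodic
  ψ-periodic (d ∷ ds) y =
    cong₂ _-_ (trans (cong (ψ ds) (lem y (+ M) (+ d))) (ψ-periodic ds (y - + d))) (ψ-periodic ds y)
    where lem : ∀ a b c → a + b - c ≡ a - c + b
          lem = solve-∀

  ψ-progression-∑≡0 : ∀ ds {d} → d ∈ ds → ∀ {j} y c → + d ≡ y * j + c * + M →
                      ∀ s → ∑< M (λ x → ψ ds (s + + x * j)) ≡ 0ℤ
  ψ-progression-∑≡0 (d ∷ ds) (here refl) {j} y c d≡yj s = begin
      ∑< M (λ x → ψ ds (s + + x * j - + d) - ψ ds (s + + x * j))
        ≡⟨ ∑<-distrib-minus M _ _ ⟩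
      ∑< M (λ x → ψ ds (s + + x * j - + d)) - ∑< M (λ x → ψ ds (s + + x * j))
        ≡⟨ cong (_- ∑< M (λ x → F (+ x))) shifted ⟩
      ∑< M (λ x → F (+ x)) - ∑< M (λ x → F (+ x))
        ≡⟨ ℤP.+-inverseʳ (∑< M (λ x → F (+ x))) ⟩
      0ℤ ∎
    where
    open ≡-Reasoning
    F : ℤ → ℤ
    F w = ψ ds (s + w * j)
    F-periodic : Periodic F
    F-periodic w = trans (cong (ψ ds) (lem s w j (+ M))) (periodic-+* (ψ-periodic ds) (s + w * j) j)
      where lem : ∀ s w j m → s + (w + m) * j ≡ s + w * j + j * m
            lem = solve-∀
    -- shifting by d ≡ y j (mod M) translates the progression index by − y
    shifted : ∑< M (λ x → ψ ds (s + + x * j - + d)) ≡ ∑< M (λ x → F (+ x))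
    shifted = begin
        ∑< M (λ x → ψ ds (s + + x * j - + d))
          ≡⟨ ∑<-cong M (λ x → trans (cong (ψ ds) (lem s (+ x) d≡yj))
                                    (periodic-+* (ψ-periodic ds) (s + (+ x + - y) * j) (- c))) ⟩
        ∑< M (λ x → F (+ x + - y))
          ≡⟨ ∑<-translate F-periodic (- y) ⟩
        ∑< M (λ x → F (+ x)) ∎
      where lem : ∀ s x → + d ≡ y * j + c * + M → s + x * j - + d ≡ s + (x + - y) * j + - c * + M
            lem s x eq rewrite eq = identity s x y j c (+ M)
              where identity : ∀ s x y j c m → s + x * j - (y * j + c * m) ≡ s + (x + - y) * j + - c * m
                    identity = solve-∀
  ψ-progression-∑≡0 (d′ ∷ ds) (there d∈ds) {j} y c d≡yj s = begin
      ∑< M (λ x → ψ ds (s + + x * j - + d′) - ψ ds (s + + x * j))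
        ≡⟨ ∑<-distrib-minus M _ _ ⟩
      ∑< M (λ x → ψ ds (s + + x * j - + d′)) - ∑< M (λ x → ψ ds (s + + x * j))
        ≡⟨ cong₂ _-_ (trans (∑<-cong M (λ x → cong (ψ ds) (lem s (+ x) j (+ d′))))
                            (ψ-progression-∑≡0 ds d∈ds y c d≡yj (s - + d′)))
                     (ψ-progression-∑≡0 ds d∈ds y c d≡yj s) ⟩
      0ℤ ∎
    where open ≡-Reasoning
          lem : ∀ s x j d → s + x * j - d ≡ s - d + x * j
          lem = solve-∀

  ψ-antiperiodic : ∀ ds {d} → d ∈ ds → + d + + d ≡ + M → ∀ t → ψ ds (t + + d) ≡ - ψ ds t
  ψ-antiperiodic (d ∷ ds) (here refl) d+d≡M t = begin
      ψ ds (t + + d - + d) - ψ ds (t + + d)   ≡⟨ cong₂ _-_ (cong (ψ ds) (lem₁ t (+ d))) back ⟩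
      ψ ds t - ψ ds (t - + d)                 ≡⟨ lem₂ (ψ ds t) (ψ ds (t - + d)) ⟩
      - (ψ ds (t - + d) - ψ ds t)             ∎
    where
    open ≡-Reasoning
    lem₁ : ∀ t d → t + d - d ≡ t
    lem₁ = solve-∀
    lem₂ : ∀ a b → a - b ≡ - (b - a)
    lem₂ = solve-∀
    back : ψ ds (t + + d) ≡ ψ ds (t - + d)
    back = trans (cong (ψ ds) (trans (lem₃ t (+ d)) (cong (λ w → t - + d + w) d+d≡M))) (ψ-periodic ds (t - + d))
      where lem₃ : ∀ t d → t + d ≡ t - d + (d + d)
            lem₃ = solve-∀
  ψ-antiperiodic (d′ ∷ ds) {d} (there d∈ds) d+d≡M t = begin
      ψ ds (t + + d - + d′) - ψ ds (t + + d)
        ≡⟨ cong₂ _-_ (trans (cong (ψ ds) (lem₁ t (+ d) (+ d′))) (ψ-antiperiodic ds d∈ds d+d≡M (t - + d′)))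
                     (ψ-antiperiodic ds d∈ds d+d≡M t) ⟩
      - ψ ds (t - + d′) - - ψ ds t   ≡⟨ lem₂ (ψ ds (t - + d′)) (ψ ds t) ⟩
      - (ψ ds (t - + d′) - ψ ds t)   ∎
    where open ≡-Reasoning
          lem₁ : ∀ t p d → t + p - d ≡ t - d + p
          lem₁ = solve-∀
          lem₂ : ∀ a b → - a - - b ≡ - (a - b)
          lem₂ = solve-∀

  -- the q-primary part of M divides t, phrased without prime powers
  PrimaryPartDivides : ℕ → ℤ → Set
  PrimaryPartDivides q t = ∃ λ c → ¬ (q ℕD.∣ ℤ.∣ c ∣) × + M ∣ t * c

  primaryPartDivides-0 : ∀ {q} → Prime q → PrimaryPartDivides q 0ℤ
  primaryPartDivides-0 q-prime = 1ℤ , (λ q∣1 → ¬prime[1] (subst Prime (ℕD.∣1⇒≡1 q∣1) q-prime)) , divides 0ℤ refl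

  primaryPartDivides-shift : ∀ {q q′} d t → Prime q → Prime q′ → q ≢ q′ → M ≡ d ℕ.* q →
                             PrimaryPartDivides q′ t → PrimaryPartDivides q′ (t - + d)
  primaryPartDivides-shift {q} {q′} d t q-prime q′-prime q≢q′ M≡dq (c , q′∤c , M∣tc) =
    c * + q , q′∤cq ,
    subst (+ M ∣_) (sym expand) (∣m∣n⇒∣m+n (∣m⇒∣m*n (+ q) M∣tc) (∣m⇒∣-m (∣m⇒∣m*n c ∣-refl)))
    where
    q′∤cq : ¬ (q′ ℕD.∣ ℤ.∣ c * + q ∣)
    q′∤cq q′∣cq with euclidsLemma ℤ.∣ c ∣ q q′-prime (subst (q′ ℕD.∣_) (ℤP.abs-* c (+ q)) q′∣cq)
    ... | inj₁ q′∣c = q′∤c q′∣c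
    ... | inj₂ q′∣q with prime⇒irreducible q-prime q′∣q
    ...   | inj₁ q′≡1 = ¬prime[1] (subst Prime q′≡1 q′-prime)
    ...   | inj₂ q′≡q = q≢q′ (sym q′≡q)
    expand : (t - + d) * (c * + q) ≡ t * c * + q + - (+ M * c)
    expand = trans (lem t (+ d) c (+ q)) (cong (λ m → t * c * + q + - (m * c)) (sym (trans (cong +_ M≡dq) (ℤP.pos-* d q))))
      where lem : ∀ t d c q → (t - d) * (c * q) ≡ t * c * q + - (d * q * c)
            lem = solve-∀

  primaryPartDivides⇒∤-shift : ∀ {q} d t → M ≢ 0 → M ≡ d ℕ.* q → PrimaryPartDivides q t → ¬ (+ M ∣ t - + d)
  primaryPartDivides⇒∤-shift {q} d t M≢0 M≡dq (c , q∤c , divides z tc≡zM) (divides w t-d≡wM) =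
    q∤c (ℕD.divides ℤ.∣ z - w * c ∣ (trans (cong ℤ.∣_∣ c≡[z-wc]q) (ℤP.abs-* (z - w * c) (+ q))))
    where
    instance
      d≢0 : ℤ.NonZero (+ d)
      d≢0 = ℤ.≢-nonZero (λ d≡0 → M≢0 (trans M≡dq (cong (ℕ._* q) (ℤP.+-injective d≡0))))
    dc≡d[z-wc]q : + d * c ≡ + d * ((z - w * c) * + q)
    dc≡d[z-wc]q = begin
        + d * c                                   ≡⟨ lem₁ t (+ d) c ⟩
        t * c - (t - + d) * c                     ≡⟨ cong₂ (λ u v → u - v * c) tc≡zM t-d≡wM ⟩
        z * + M - w * + M * c                     ≡⟨ cong (λ m → z * m - w * m * c) (trans (cong +_ M≡dq) (ℤP.pos-* d q)) ⟩
        z * (+ d * + q) - w * (+ d * + q) * c     ≡⟨ lem₂ z w (+ d) (+ q) c ⟩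
        + d * ((z - w * c) * + q)                 ∎
      where open ≡-Reasoning
            lem₁ : ∀ t d c → d * c ≡ t * c - (t - d) * c
            lem₁ = solve-∀
            lem₂ : ∀ z w d q c → z * (d * q) - w * (d * q) * c ≡ d * ((z - w * c) * q)
            lem₂ = solve-∀
    c≡[z-wc]q : c ≡ (z - w * c) * + q
    c≡[z-wc]q = ℤP.*-cancelˡ-≡ (+ d) c _ dc≡d[z-wc]q

  Cofactors : List (ℕ × ℕ) → Set
  Cofactors = All (λ p → Prime (proj₁ p) × M ≡ proj₂ p ℕ.* proj₁ p)

  DistinctPrimes : List (ℕ × ℕ) → Set
  DistinctPrimes = AllPairs (λ p p′ → proj₁ p ≢ proj₁ p′)

  private
    primaryPartsDivide-shift : ∀ {q} d t L → Prime q → M ≡ d ℕ.* q → Cofactors L → All (λ p → q ≢ proj₁ p) L →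
                               All (λ p → PrimaryPartDivides (proj₁ p) t) L →
                               All (λ p → PrimaryPartDivides (proj₁ p) (t - + d)) L
    primaryPartsDivide-shift d t []      _       _    []                 []           []         = []
    primaryPartsDivide-shift d t (_ ∷ L) q-prime M≡dq ((p-prime , _) ∷ L-cof) (q≢p ∷ q≢L) (div ∷ divs) =
      primaryPartDivides-shift d t q-prime p-prime q≢p M≡dq div
        ∷ primaryPartsDivide-shift d t L q-prime M≡dq L-cof q≢L divs

  -- the hypothesis survives the shift t ↦ t − M/q for the primes q′ ≠ q, and rules out M ∣ t − M/q
  ∣ψ∣≡∣δ∣ : M ≢ 0 → ∀ L → Cofactors L → DistinctPrimes L →
            ∀ t → All (λ p → PrimaryPartDivides (proj₁ p) t) L → ℤ.∣ ψ (map proj₂ L) t ∣ ≡ ℤ.∣ δ t ∣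
  ∣ψ∣≡∣δ∣ M≢0 []            []                   []            t []           = refl
  ∣ψ∣≡∣δ∣ M≢0 ((q , d) ∷ L) ((q-prime , M≡dq) ∷ L-cof) (q≢L ∷ L-dist) t (div ∷ divs) = begin
      ℤ.∣ ψ ds (t - + d) - ψ ds t ∣   ≡⟨ cong (λ u → ℤ.∣ u - ψ ds t ∣) shifted≡0 ⟩
      ℤ.∣ 0ℤ - ψ ds t ∣               ≡⟨ cong ℤ.∣_∣ (ℤP.+-identityˡ (- ψ ds t)) ⟩
      ℤ.∣ - ψ ds t ∣                  ≡⟨ ℤP.∣-i∣≡∣i∣ (ψ ds t) ⟩
      ℤ.∣ ψ ds t ∣                    ≡⟨ ∣ψ∣≡∣δ∣ M≢0 L L-cof L-dist t divs ⟩
      ℤ.∣ δ t ∣                       ∎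
    where
    open ≡-Reasoning
    ds = map proj₂ L
    shifted≡0 : ψ ds (t - + d) ≡ 0ℤ
    shifted≡0 = ℤP.∣i∣≡0⇒i≡0 (begin
        ℤ.∣ ψ ds (t - + d) ∣
          ≡⟨ ∣ψ∣≡∣δ∣ M≢0 L L-cof L-dist (t - + d) (primaryPartsDivide-shift d t L q-prime M≡dq L-cof q≢L divs) ⟩
        ℤ.∣ δ (t - + d) ∣
          ≡⟨ cong ℤ.∣_∣ (indicator-no (+ M ∣? (t - + d)) (primaryPartDivides⇒∤-shift d t M≢0 M≡dq div)) ⟩
        0 ∎)

  ψ-0≢0 : M ≢ 0 → ∀ L → Cofactors L → DistinctPrimes L → ψ (map proj₂ L) 0ℤ ≢ 0ℤ
  ψ-0≢0 M≢0 L L-cof L-dist ψ0≡0 = 1≢0 (begin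
      1                             ≡⟨ cong ℤ.∣_∣ (sym (indicator-yes (+ M ∣? 0ℤ) (divides 0ℤ refl))) ⟩
      ℤ.∣ δ 0ℤ ∣                    ≡⟨ sym (∣ψ∣≡∣δ∣ M≢0 L L-cof L-dist 0ℤ (all-divide L L-cof)) ⟩
      ℤ.∣ ψ (map proj₂ L) 0ℤ ∣      ≡⟨ cong ℤ.∣_∣ ψ0≡0 ⟩
      0                             ∎)
    where
    open ≡-Reasoning
    1≢0 : 1 ≢ 0
    1≢0 ()
    all-divide : ∀ L → Cofactors L → All (λ p → PrimaryPartDivides (proj₁ p) 0ℤ) L
    all-divide L L-cof = All.map (λ cof → primaryPartDivides-0 (proj₁ cof)) L-cof

  primeCofactorsBelow : ℕ → List (ℕ × ℕ)
  primeCofactorsBelow zero    = []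
  primeCofactorsBelow (suc n) with prime? n ×-dec n ℕD.∣? M
  ... | yes (_ , ℕD.divides d _) = (n , d) ∷ primeCofactorsBelow n
  ... | no _                     = primeCofactorsBelow n

  primeCofactorsBelow-cofactors : ∀ n → Cofactors (primeCofactorsBelow n)
  primeCofactorsBelow-cofactors zero    = []
  primeCofactorsBelow-cofactors (suc n) with prime? n ×-dec n ℕD.∣? M
  ... | yes (n-prime , ℕD.divides d M≡dn) = (n-prime , M≡dn) ∷ primeCofactorsBelow-cofactors n
  ... | no _                             = primeCofactorsBelow-cofactors n

  primeCofactorsBelow-< : ∀ n → All (λ p → proj₁ p < n) (primeCofactorsBelow n)
  primeCofactorsBelow-< zero    = []
  primeCofactorsBelow-< (suc n) with prime? n ×-dec n ℕD.∣? M
  ... | yes _ = ℕP.≤-refl ∷ All.map ℕP.m<n⇒m<1+n (primeCofactorsBelow-< n)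
  ... | no _  = All.map ℕP.m<n⇒m<1+n (primeCofactorsBelow-< n)

  primeCofactorsBelow-distinct : ∀ n → DistinctPrimes (primeCofactorsBelow n)
  primeCofactorsBelow-distinct zero    = []
  primeCofactorsBelow-distinct (suc n) with prime? n ×-dec n ℕD.∣? M
  ... | yes _ = All.map (λ q<n n≡q → ℕP.<-irrefl (sym n≡q) q<n) (primeCofactorsBelow-< n)
                  ∷ primeCofactorsBelow-distinct n
  ... | no _  = primeCofactorsBelow-distinct n

  primeCofactorsBelow-complete : ∀ n {q} → q < n → Prime q → q ℕD.∣ M → ∃ λ d → (q , d) ∈ primeCofactorsBelow n
  primeCofactorsBelow-complete (suc n) q<1+n q-prime q∣M with ℕP.m<1+n⇒m<n∨m≡n q<1+n | prime? n ×-dec n ℕD.∣? M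
  ... | inj₁ q<n  | yes _ = let d , q∈ = primeCofactorsBelow-complete n q<n q-prime q∣M in d , there q∈
  ... | inj₁ q<n  | no _  = primeCofactorsBelow-complete n q<n q-prime q∣M
  ... | inj₂ refl | yes (_ , ℕD.divides d _) = d , here refl
  ... | inj₂ refl | no ¬q-prime∧q∣M = ⊥-elim (¬q-prime∧q∣M (q-prime , q∣M))

  shifts : List ℕ
  shifts = map proj₂ (primeCofactorsBelow (suc M))

  cofactor∈shifts : M ≢ 0 → ∀ {q d} → Prime q → M ≡ d ℕ.* q → d ∈ shifts
  cofactor∈shifts M≢0 {q} {d} q-prime M≡dq = subst (_∈ shifts) d′≡d (∈-map⁺ proj₂ qd′∈)
    where
    instance
      _ = ℕ.≢-nonZero M≢0
      _ = prime⇒nonZero q-prime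
    q∣M : q ℕD.∣ M
    q∣M = ℕD.divides d M≡dq
    found = primeCofactorsBelow-complete (suc M) (ℕ.s≤s (ℕD.∣⇒≤ q∣M)) q-prime q∣M
    d′ = proj₁ found
    qd′∈ = proj₂ found
    d′≡d : d′ ≡ d
    d′≡d = ℕP.*-cancelʳ-≡ d′ d q (trans (sym (proj₂ (All.lookup (primeCofactorsBelow-cofactors (suc M)) qd′∈))) M≡dq)

  private
    ∣j∣≡±j : ∀ j → ∃ λ ε → + ℤ.∣ j ∣ ≡ ε * j
    ∣j∣≡±j (+ n)    = 1ℤ , sym (ℤP.*-identityˡ (+ n))
    ∣j∣≡±j -[1+ n ] = - 1ℤ , sym (ℤP.-1*i≡-i -[1+ n ])

  -- for a prime factor q of M / gcd(j, M), the shift M / q is a multiple of gcd(j, M), hence by Bézout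
  -- a multiple of j modulo M
  shift≡multiple : M ≢ 0 → ∀ {j} → ¬ (+ M ∣ j) → ∃ λ d → d ∈ shifts × ∃₂ λ y c → + d ≡ y * j + c * + M
  shift≡multiple M≢0 {j} M∤j with Bézout.lemma ℤ.∣ j ∣ M
  ... | Bézout.result g g-gcd g-identity with proj₂ (GCD.commonDivisor g-gcd)
  ...   | ℕD.divides r M≡rg = from-quotient r M≡rg
    where
    from-quotient : ∀ r → M ≡ r ℕ.* g → ∃ λ d → d ∈ shifts × ∃₂ λ y c → + d ≡ y * j + c * + M
    from-quotient zero          M≡0  = ⊥-elim (M≢0 M≡0)
    from-quotient (suc zero)    M≡g  =
      ⊥-elim (M∤j (∣ᵤ⇒∣ (subst (ℕD._∣ ℤ.∣ j ∣) (sym (trans M≡g (ℕP.+-identityʳ g)))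
                              (proj₁ (GCD.commonDivisor g-gcd)))))
    from-quotient r@(suc (suc _)) M≡rg with factorise r
    ... | record { factors = [] ; isFactorisation = () }
    ... | record { factors = q ∷ fs ; isFactorisation = r≡qs ; factorsPrime = q-prime ∷ _ } =
      s ℕ.* g , cofactor∈shifts M≢0 q-prime M≡[sg]q , + s * X * ε , + s * Y , sg≡
      where
      s = product fs
      M≡[sg]q : M ≡ s ℕ.* g ℕ.* q
      M≡[sg]q = trans M≡rg (trans (cong (ℕ._* g) r≡qs) (lem q s g))
        where lem : ∀ q s g → q ℕ.* s ℕ.* g ≡ s ℕ.* g ℕ.* q
              lem q s g = trans (ℕP.*-assoc q s g) (ℕP.*-comm q (s ℕ.* g))
      X = proj₁ (bézout-ℤ g-identity)
      Y = proj₁ (proj₂ (bézout-ℤ g-identity))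
      ε = proj₁ (∣j∣≡±j j)
      sg≡ : + (s ℕ.* g) ≡ + s * X * ε * j + + s * Y * + M
      sg≡ = begin
          + (s ℕ.* g)                            ≡⟨ ℤP.pos-* s g ⟩
          + s * + g                              ≡⟨ cong (+ s *_) (proj₂ (proj₂ (bézout-ℤ g-identity))) ⟩
          + s * (X * + ℤ.∣ j ∣ + Y * + M)        ≡⟨ cong (λ w → + s * (X * w + Y * + M)) (proj₂ (∣j∣≡±j j)) ⟩
          + s * (X * (ε * j) + Y * + M)          ≡⟨ lem (+ s) X Y ε j (+ M) ⟩
          + s * X * ε * j + + s * Y * + M        ∎
        where open ≡-Reasoning
              lem : ∀ s X Y ε j m → s * (X * (ε * j) + Y * m) ≡ s * X * ε * j + s * Y * m
              lem = solve-∀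

evenCharacter : ∀ P → .{{NonZero P}} → Character (P ℕ.+ P) (+ P)
evenCharacter P = record
  { χ               = ψ shifts
  ; periodic        = ψ-periodic shifts
  ; progression-∑≡0 = λ M∤j s → let _ , d∈ , y , c , d≡yj = shift≡multiple M≢0 M∤j in
                                 ψ-progression-∑≡0 shifts d∈ y c d≡yj s
  ; antiperiodic    = ψ-antiperiodic shifts (cofactor∈shifts M≢0 prime[2] M≡P*2) (sym (ℤP.pos-+ P P))
  ; χ-0≢0           = ψ-0≢0 M≢0 _ (primeCofactorsBelow-cofactors (suc M)) (primeCofactorsBelow-distinct (suc M))
  }
  where
  M = P ℕ.+ P
  open DifferencedIndicator M
  M≢0 : M ≢ 0
  M≢0 = ℕ.≢-nonZero⁻¹ P ∘ ℕP.m+n≡0⇒m≡0 P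
  M≡P*2 : M ≡ P ℕ.* 2
  M≡P*2 = trans (cong (P ℕ.+_) (sym (ℕP.+-identityʳ P))) (ℕP.*-comm 2 P)

-- Sums over subsets and supersets

sumIn : ∀ {k} → Subset k → (Fin k → ℤ) → ℤ
sumIn []            f = 0ℤ
sumIn (inside  ∷ I) f = f zero + sumIn I (f ∘ suc)
sumIn (outside ∷ I) f = sumIn I (f ∘ suc)

sumIn-cong : ∀ {k} (I : Subset k) {f g : Fin k → ℤ} → (∀ s → f s ≡ g s) → sumIn I f ≡ sumIn I g
sumIn-cong []            f≗g = refl
sumIn-cong (inside  ∷ I) f≗g = cong₂ _+_ (f≗g zero) (sumIn-cong I (f≗g ∘ suc))
sumIn-cong (outside ∷ I) f≗g = sumIn-cong I (f≗g ∘ suc)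

sumIn-distrib-+ : ∀ {k} (I : Subset k) (f g : Fin k → ℤ) → sumIn I (λ s → f s + g s) ≡ sumIn I f + sumIn I g
sumIn-distrib-+ []            f g = refl
sumIn-distrib-+ (inside  ∷ I) f g =
  trans (cong (ℤ._+_ (f zero + g zero)) (sumIn-distrib-+ I (f ∘ suc) (g ∘ suc)))
        (+-interchange (f zero) (g zero) (sumIn I (f ∘ suc)) (sumIn I (g ∘ suc)))
sumIn-distrib-+ (outside ∷ I) f g = sumIn-distrib-+ I (f ∘ suc) (g ∘ suc)

sumIn-distrib-minus : ∀ {k} (I : Subset k) (f g : Fin k → ℤ) → sumIn I (λ s → f s - g s) ≡ sumIn I f - sumIn I g
sumIn-distrib-minus []            f g = refl
sumIn-distrib-minus (inside  ∷ I) f g =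
  trans (cong (ℤ._+_ (f zero - g zero)) (sumIn-distrib-minus I (f ∘ suc) (g ∘ suc)))
        (lem (f zero) (g zero) (sumIn I (f ∘ suc)) (sumIn I (g ∘ suc)))
  where lem : ∀ a b c d → a - b + (c - d) ≡ a + c - (b + d)
        lem = solve-∀
sumIn-distrib-minus (outside ∷ I) f g = sumIn-distrib-minus I (f ∘ suc) (g ∘ suc)

sumIn-*ˡ : ∀ {k} (I : Subset k) c (f : Fin k → ℤ) → sumIn I (λ s → c * f s) ≡ c * sumIn I f
sumIn-*ˡ []            c f = sym (ℤP.*-zeroʳ c)
sumIn-*ˡ (inside  ∷ I) c f = trans (cong (ℤ._+_ (c * f zero)) (sumIn-*ˡ I c (f ∘ suc))) (sym (ℤP.*-distribˡ-+ c _ _))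
sumIn-*ˡ (outside ∷ I) c f = sumIn-*ˡ I c (f ∘ suc)

sumIn-const : ∀ {k} (I : Subset k) c → sumIn I (λ _ → c) ≡ + ∣ I ∣ * c
sumIn-const []            c = refl
sumIn-const (inside  ∷ I) c = trans (cong (ℤ._+_ c) (sumIn-const I c)) (lem (+ ∣ I ∣) c)
  where lem : ∀ n c → c + n * c ≡ (1ℤ + n) * c
        lem = solve-∀
sumIn-const (outside ∷ I) c = sumIn-const I c

sumIn-zero : ∀ {k} (I : Subset k) {f : Fin k → ℤ} → (∀ s → f s ≡ 0ℤ) → sumIn I f ≡ 0ℤ
sumIn-zero []            f≗0 = refl
sumIn-zero (inside  ∷ I) f≗0 = cong₂ _+_ (f≗0 zero) (sumIn-zero I (f≗0 ∘ suc))
sumIn-zero (outside ∷ I) f≗0 = sumIn-zero I (f≗0 ∘ suc)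

sign : ∀ {k} → Subset k → ℤ
sign []            = 1ℤ
sign (inside  ∷ I) = - sign I
sign (outside ∷ I) = sign I

sign-antiperiodic : ∀ {k} (χ : ℤ → ℤ) P → (∀ t → χ (t + P) ≡ - χ t) →
                    (I : Subset k) → ∀ x → sign I * χ (x + + ∣ I ∣ * P) ≡ χ x
sign-antiperiodic χ P χ-anti []            x = trans (ℤP.*-identityˡ _) (cong χ (ℤP.+-identityʳ x))
sign-antiperiodic χ P χ-anti (outside ∷ I) x = sign-antiperiodic χ P χ-anti I x
sign-antiperiodic χ P χ-anti (inside  ∷ I) x = begin
    - sign I * χ (x + (1ℤ + + ∣ I ∣) * P)    ≡⟨ cong (λ u → - sign I * χ u) (lem₁ x (+ ∣ I ∣) P) ⟩
    - sign I * χ (x + + ∣ I ∣ * P + P)       ≡⟨ cong (- sign I *_) (χ-anti (x + + ∣ I ∣ * P)) ⟩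
    - sign I * - χ (x + + ∣ I ∣ * P)         ≡⟨ lem₂ (sign I) (χ (x + + ∣ I ∣ * P)) ⟩
    sign I * χ (x + + ∣ I ∣ * P)             ≡⟨ sign-antiperiodic χ P χ-anti I x ⟩
    χ x                                      ∎
  where open ≡-Reasoning
        lem₁ : ∀ x n p → x + (1ℤ + n) * p ≡ x + n * p + p
        lem₁ = solve-∀
        lem₂ : ∀ a b → - a * - b ≡ a * b
        lem₂ = solve-∀

sumSupersets : ∀ {k} → Subset k → (Subset k → ℤ) → ℤ
sumSupersets []            F = F []
sumSupersets (inside  ∷ T) F = sumSupersets T (F ∘ (inside ∷_))
sumSupersets (outside ∷ T) F = sumSupersets T (F ∘ (outside ∷_)) + sumSupersets T (F ∘ (inside ∷_))

sumSupersets-cong : ∀ {k} (T : Subset k) {F G : Subset k → ℤ} → (∀ I → F I ≡ G I) → sumSupersets T F ≡ sumSupersets T G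
sumSupersets-cong []            F≗G = F≗G []
sumSupersets-cong (inside  ∷ T) F≗G = sumSupersets-cong T (F≗G ∘ (inside ∷_))
sumSupersets-cong (outside ∷ T) F≗G =
  cong₂ _+_ (sumSupersets-cong T (F≗G ∘ (outside ∷_))) (sumSupersets-cong T (F≗G ∘ (inside ∷_)))

sumSupersets-distrib-+ : ∀ {k} (T : Subset k) (F G : Subset k → ℤ) →
                         sumSupersets T (λ I → F I + G I) ≡ sumSupersets T F + sumSupersets T G
sumSupersets-distrib-+ []            F G = refl
sumSupersets-distrib-+ (inside  ∷ T) F G = sumSupersets-distrib-+ T (F ∘ (inside ∷_)) (G ∘ (inside ∷_))
sumSupersets-distrib-+ (outside ∷ T) F G =
  trans (cong₂ _+_ (sumSupersets-distrib-+ T (F ∘ (outside ∷_)) (G ∘ (outside ∷_)))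
                   (sumSupersets-distrib-+ T (F ∘ (inside ∷_)) (G ∘ (inside ∷_))))
        (+-interchange (sumSupersets T (F ∘ (outside ∷_))) (sumSupersets T (G ∘ (outside ∷_)))
                       (sumSupersets T (F ∘ (inside ∷_))) (sumSupersets T (G ∘ (inside ∷_))))

sumSupersets-*ˡ : ∀ {k} (T : Subset k) c (F : Subset k → ℤ) → sumSupersets T (λ I → c * F I) ≡ c * sumSupersets T F
sumSupersets-*ˡ []            c F = refl
sumSupersets-*ˡ (inside  ∷ T) c F = sumSupersets-*ˡ T c (F ∘ (inside ∷_))
sumSupersets-*ˡ (outside ∷ T) c F =
  trans (cong₂ _+_ (sumSupersets-*ˡ T c (F ∘ (outside ∷_))) (sumSupersets-*ˡ T c (F ∘ (inside ∷_))))
        (sym (ℤP.*-distribˡ-+ c _ _))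

sumSupersets-neg : ∀ {k} (T : Subset k) (F : Subset k → ℤ) → sumSupersets T (λ I → - F I) ≡ - sumSupersets T F
sumSupersets-neg T F = begin
  sumSupersets T (λ I → - F I)          ≡⟨ sumSupersets-cong T (λ I → sym (ℤP.-1*i≡-i (F I))) ⟩
  sumSupersets T (λ I → - 1ℤ * F I)     ≡⟨ sumSupersets-*ˡ T (- 1ℤ) F ⟩
  - 1ℤ * sumSupersets T F               ≡⟨ ℤP.-1*i≡-i (sumSupersets T F) ⟩
  - sumSupersets T F                    ∎
  where open ≡-Reasoning

sumSupersets-distrib-minus : ∀ {k} (T : Subset k) (F G : Subset k → ℤ) →
                         sumSupersets T (λ I → F I - G I) ≡ sumSupersets T F - sumSupersets T G
sumSupersets-distrib-minus T F G =
  trans (sumSupersets-distrib-+ T F (λ I → - G I)) (cong (ℤ._+_ (sumSupersets T F)) (sumSupersets-neg T G))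

sumSupersets-∑< : ∀ {k} (T : Subset k) n (F : ℕ → Subset k → ℤ) →
                  sumSupersets T (λ I → ∑< n (λ x → F x I)) ≡ ∑< n (λ x → sumSupersets T (F x))
sumSupersets-∑< T zero    F = trans (sumSupersets-cong T (λ _ → sym (ℤP.*-zeroˡ 0ℤ))) (sumSupersets-*ˡ T 0ℤ (λ _ → 0ℤ))
sumSupersets-∑< T (suc n) F =
  trans (sumSupersets-distrib-+ T _ (F n)) (cong (_+ sumSupersets T (F n)) (sumSupersets-∑< T n F))

private
  alternating-term-inside : ∀ {k} (T : Subset k) (χ : ℤ → ℤ) (c : Fin (suc k) → ℤ) t I →
                - sign I * χ (t + (c zero + sumIn I (c ∘ suc))) ≡ - (sign I * χ (t + sumIn I (c ∘ suc) + c zero))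
  alternating-term-inside T χ c t I =
    trans (cong (λ u → - sign I * χ u) (lem t (c zero) (sumIn I (c ∘ suc)))) (sym (ℤP.neg-distribˡ-* (sign I) _))
    where lem : ∀ t a b → t + (a + b) ≡ t + b + a
          lem = solve-∀

  alternating-sum-inside : ∀ {k} (T : Subset k) (χ : ℤ → ℤ) (c : Fin (suc k) → ℤ) t →
            sumSupersets T (λ I → - sign I * χ (t + (c zero + sumIn I (c ∘ suc))))
              ≡ - sumSupersets T (λ I → sign I * χ (t + c zero + sumIn I (c ∘ suc)))
  alternating-sum-inside T χ c t =
    trans (sumSupersets-cong T (λ I → trans (cong (λ u → - sign I * χ u) (sym (ℤP.+-assoc t (c zero) _)))
                                            (sym (ℤP.neg-distribˡ-* (sign I) _))))
          (sumSupersets-neg T _)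

-- adding s to I flips the sign and, as χ has period c s, keeps the value of χ
sumSupersets-alternating≡0 : ∀ {k} (T : Subset k) (χ : ℤ → ℤ) (c : Fin k → ℤ) {s} → lookup T s ≡ outside →
                             (∀ y → χ (y + c s) ≡ χ y) →
                             ∀ t → sumSupersets T (λ I → sign I * χ (t + sumIn I c)) ≡ 0ℤ
sumSupersets-alternating≡0 (outside ∷ T) χ c {zero} refl χ-periodic t = begin
    S + sumSupersets T (λ I → - sign I * χ (t + (c zero + sumIn I (c ∘ suc))))
      ≡⟨ cong (ℤ._+_ S) (trans (sumSupersets-cong T (λ I → trans (alternating-term-inside T χ c t I)
                                                              (cong (λ u → - (sign I * u)) (χ-periodic _))))
                            (sumSupersets-neg T _)) ⟩
    S - S  ≡⟨ ℤP.+-inverseʳ S ⟩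
    0ℤ     ∎
  where open ≡-Reasoning
        S = sumSupersets T (λ I → sign I * χ (t + sumIn I (c ∘ suc)))
sumSupersets-alternating≡0 (inside ∷ T) χ c {suc s} s∉T χ-periodic t =
  trans (alternating-sum-inside T χ c t) (cong -_ (sumSupersets-alternating≡0 T χ (c ∘ suc) s∉T χ-periodic (t + c zero)))
sumSupersets-alternating≡0 (outside ∷ T) χ c {suc s} s∉T χ-periodic t =
  cong₂ _+_ (sumSupersets-alternating≡0 T χ (c ∘ suc) s∉T χ-periodic t)
            (trans (alternating-sum-inside T χ c t)
                   (cong -_ (sumSupersets-alternating≡0 T χ (c ∘ suc) s∉T χ-periodic (t + c zero))))

private
  sumSupersets-*[+sumIn] : ∀ {k} (T : Subset k) (F : Subset k → ℤ) c (d : Fin k → ℤ) →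
                           sumSupersets T (λ I → F I * (c + sumIn I d))
                             ≡ c * sumSupersets T F + sumSupersets T (λ I → F I * sumIn I d)
  sumSupersets-*[+sumIn] T F c d = begin
      sumSupersets T (λ I → F I * (c + sumIn I d))             ≡⟨ sumSupersets-cong T (λ I → lem (F I) c (sumIn I d)) ⟩
      sumSupersets T (λ I → c * F I + F I * sumIn I d)         ≡⟨ sumSupersets-distrib-+ T _ _ ⟩
      sumSupersets T (λ I → c * F I) + sumSupersets T (λ I → F I * sumIn I d)
        ≡⟨ cong (_+ sumSupersets T (λ I → F I * sumIn I d)) (sumSupersets-*ˡ T c F) ⟩
      c * sumSupersets T F + sumSupersets T (λ I → F I * sumIn I d) ∎
    where open ≡-Reasoning
          lem : ∀ f c s → f * (c + s) ≡ c * f + f * s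
          lem = solve-∀

sumSupersets-*sumIn : ∀ {k} (T : Subset k) (F : Subset k → ℤ) (d : Fin k → ℤ) →
                      sumSupersets T (λ I → F I * sumIn I d) ≡ sumIn ⊤ (λ s → d s * sumSupersets (T [ s ]≔ inside) F)
sumSupersets-*sumIn []            F d = ℤP.*-zeroʳ (F [])
sumSupersets-*sumIn (inside  ∷ T) F d =
  trans (sumSupersets-*[+sumIn] T (F ∘ (inside ∷_)) (d zero) (d ∘ suc))
        (cong (ℤ._+_ (d zero * sumSupersets T (F ∘ (inside ∷_)))) (sumSupersets-*sumIn T (F ∘ (inside ∷_)) (d ∘ suc)))
sumSupersets-*sumIn (outside ∷ T) F d = begin
    sumSupersets T (λ I → F (outside ∷ I) * sumIn I (d ∘ suc))
      + sumSupersets T (λ I → F (inside ∷ I) * (d zero + sumIn I (d ∘ suc)))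
      ≡⟨ cong₂ _+_ (sumSupersets-*sumIn T (F ∘ (outside ∷_)) (d ∘ suc))
                   (trans (sumSupersets-*[+sumIn] T (F ∘ (inside ∷_)) (d zero) (d ∘ suc))
                          (cong (ℤ._+_ B) (sumSupersets-*sumIn T (F ∘ (inside ∷_)) (d ∘ suc)))) ⟩
    sumIn ⊤ (λ s → d (suc s) * S₀ s) + (B + sumIn ⊤ (λ s → d (suc s) * S₁ s))
      ≡⟨ lem (sumIn ⊤ (λ s → d (suc s) * S₀ s)) B (sumIn ⊤ (λ s → d (suc s) * S₁ s)) ⟩
    B + (sumIn ⊤ (λ s → d (suc s) * S₀ s) + sumIn ⊤ (λ s → d (suc s) * S₁ s))
      ≡⟨ cong (ℤ._+_ B) (trans (sym (sumIn-distrib-+ ⊤ (λ s → d (suc s) * S₀ s) (λ s → d (suc s) * S₁ s)))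
                               (sumIn-cong ⊤ (λ s → sym (ℤP.*-distribˡ-+ (d (suc s)) (S₀ s) (S₁ s))))) ⟩
    B + sumIn ⊤ (λ s → d (suc s) * (S₀ s + S₁ s))
      ∎
  where open ≡-Reasoning
        B = d zero * sumSupersets T (F ∘ (inside ∷_))
        S₀ S₁ : Fin _ → ℤ
        S₀ s = sumSupersets (T [ s ]≔ inside) (F ∘ (outside ∷_))
        S₁ s = sumSupersets (T [ s ]≔ inside) (F ∘ (inside ∷_))
        lem : ∀ a b c → a + (b + c) ≡ b + (a + c)
        lem = solve-∀

∣[]≔inside∣≤ : ∀ {k} (T : Subset k) s → ∣ T [ s ]≔ inside ∣ ≤ suc ∣ T ∣
∣[]≔inside∣≤ (inside  ∷ T) zero    = ℕP.n≤1+n _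
∣[]≔inside∣≤ (outside ∷ T) zero    = ℕP.≤-refl
∣[]≔inside∣≤ (inside  ∷ T) (suc s) = ℕ.s≤s (∣[]≔inside∣≤ T s)
∣[]≔inside∣≤ (outside ∷ T) (suc s) = ∣[]≔inside∣≤ T s

private
  +N*C++N′*C : ∀ N N′ C → + N * C + + N′ * C ≡ + (N ℕ.+ N′) * C
  +N*C++N′*C N N′ C = trans (sym (ℤP.*-distribʳ-+ C (+ N) (+ N′))) (cong (_* C) (sym (ℤP.pos-+ N N′)))

sumAll-0∨C : ∀ {k} (F : Subset k → ℤ) C → (∀ I → F I ≡ 0ℤ ⊎ F I ≡ C) → ∃ λ N → sumSupersets ⊥ F ≡ + N * C
sumAll-0∨C {zero}  F C F∈0C with F∈0C []
... | inj₁ F≡0 = 0 , trans F≡0 (sym (ℤP.*-zeroˡ C))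
... | inj₂ F≡C = 1 , trans F≡C (sym (ℤP.*-identityˡ C))
sumAll-0∨C {suc k} F C F∈0C =
  let N₀ , eq₀ = sumAll-0∨C (F ∘ (outside ∷_)) C (F∈0C ∘ (outside ∷_))
      N₁ , eq₁ = sumAll-0∨C (F ∘ (inside ∷_)) C (F∈0C ∘ (inside ∷_))
  in N₀ ℕ.+ N₁ , trans (cong₂ _+_ eq₀ eq₁) (+N*C++N′*C N₀ N₁ C)

sumAll-0∨C-∋C : ∀ {k} (F : Subset k → ℤ) C → (∀ I → F I ≡ 0ℤ ⊎ F I ≡ C) → ∀ J → F J ≡ C →
                ∃ λ N → sumSupersets ⊥ F ≡ + suc N * C
sumAll-0∨C-∋C F C F∈0C [] F≡C = 0 , trans F≡C (sym (ℤP.*-identityˡ C))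
sumAll-0∨C-∋C F C F∈0C (outside ∷ J) FJ≡C =
  let N₀ , eq₀ = sumAll-0∨C-∋C (F ∘ (outside ∷_)) C (F∈0C ∘ (outside ∷_)) J FJ≡C
      N₁ , eq₁ = sumAll-0∨C (F ∘ (inside ∷_)) C (F∈0C ∘ (inside ∷_))
  in N₀ ℕ.+ N₁ , trans (cong₂ _+_ eq₀ eq₁) (+N*C++N′*C (suc N₀) N₁ C)
sumAll-0∨C-∋C F C F∈0C (inside ∷ J) FJ≡C =
  let N₀ , eq₀ = sumAll-0∨C (F ∘ (outside ∷_)) C (F∈0C ∘ (outside ∷_))
      N₁ , eq₁ = sumAll-0∨C-∋C (F ∘ (inside ∷_)) C (F∈0C ∘ (inside ∷_)) J FJ≡C
  in N₀ ℕ.+ N₁ , trans (cong₂ _+_ eq₀ eq₁)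
                       (trans (+N*C++N′*C N₀ (suc N₁) C) (cong (λ n → + n * C) (ℕP.+-suc N₀ N₁)))

allSubsets : ∀ k → List (Subset k)
allSubsets zero    = [] ∷ []
allSubsets (suc k) = map (outside ∷_) (allSubsets k) ++ map (inside ∷_) (allSubsets k)

∈-allSubsets : ∀ {k} (I : Subset k) → I ∈ allSubsets k
∈-allSubsets []            = here refl
∈-allSubsets (outside ∷ I) = ∈-++⁺ˡ (∈-map⁺ (outside ∷_) (∈-allSubsets I))
∈-allSubsets {suc k} (inside ∷ I) = ∈-++⁺ʳ (map (outside ∷_) (allSubsets k)) (∈-map⁺ (inside ∷_) (∈-allSubsets I))

Unique-lookup-injective : ∀ {A : Set} {xs : List A} → Unique xs → ∀ i j → List.lookup xs i ≡ List.lookup xs j → i ≡ j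
Unique-lookup-injective (_    ∷ _)     zero    zero    _  = refl
Unique-lookup-injective (x∉xs ∷ _)     zero    (suc j) eq = ⊥-elim (All.lookup x∉xs (∈-lookup j) eq)
Unique-lookup-injective (x∉xs ∷ _)     (suc i) zero    eq = ⊥-elim (All.lookup x∉xs (∈-lookup i) (sym eq))
Unique-lookup-injective (_    ∷ uniq)  (suc i) (suc j) eq = cong suc (Unique-lookup-injective uniq i j eq)

private
  length-filter-tabulate-suc : ∀ {k} {P : Fin (suc k) → Set} (P? : ∀ s → Dec (P s)) →
                               length (filter P? (tabulate suc)) ≡ length (filter (P? ∘ suc) (allFin k))
  length-filter-tabulate-suc {k} P? = begin
      length (filter P? (tabulate suc))                ≡⟨ cong (length ∘ filter P?) (sym (LP.map-tabulate (λ s → s) suc)) ⟩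
      length (filter P? (map suc (allFin k)))          ≡⟨ cong length (filter-map-suc (allFin k)) ⟩
      length (map suc (filter (P? ∘ suc) (allFin k)))  ≡⟨ LP.length-map suc (filter (P? ∘ suc) (allFin k)) ⟩
      length (filter (P? ∘ suc) (allFin k))            ∎
    where
    open ≡-Reasoning
    filter-map-suc : ∀ xs → filter P? (map suc xs) ≡ map suc (filter (P? ∘ suc) xs)
    filter-map-suc []       = refl
    filter-map-suc (x ∷ xs) with P? (suc x)
    ... | yes _ = cong (suc x ∷_) (filter-map-suc xs)
    ... | no  _ = filter-map-suc xs

pigeonhole-∉ : ∀ {k} {P : Fin k → Set} (P? : ∀ s → Dec (P s)) (T : Subset k) →
               ∣ T ∣ < length (filter P? (allFin k)) → ∃ λ s → lookup T s ≡ outside × P s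
pigeonhole-∉-tail : ∀ {k} {P : Fin (suc k) → Set} (P? : ∀ s → Dec (P s)) {b} (T : Subset k) →
          ∣ T ∣ < length (filter P? (tabulate suc)) → ∃ λ s → lookup (b ∷ T) s ≡ outside × P s

pigeonhole-∉ {suc k} P? (b ∷ T) ∣T∣<count with P? zero | b
... | yes p | outside = zero , refl , p
... | yes _ | inside  = pigeonhole-∉-tail P? T (ℕP.≤-pred ∣T∣<count)
... | no _  | outside = pigeonhole-∉-tail P? T ∣T∣<count
... | no _  | inside  = pigeonhole-∉-tail P? T (ℕP.<-trans (ℕP.n<1+n ∣ T ∣) ∣T∣<count)

pigeonhole-∉-tail P? T ∣T∣<count =
  Product.map suc (λ x → x) (pigeonhole-∉ (P? ∘ suc) T (subst (∣ T ∣ <_) (length-filter-tabulate-suc P?) ∣T∣<count))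

-- The polynomial method

∏-minus : List ℤ → ℤ → ℤ
∏-minus []       e = 1ℤ
∏-minus (b ∷ bs) e = (e - b) * ∏-minus bs e

∏-minus-∈ : ∀ {bs e} → e ∈ bs → ∏-minus bs e ≡ 0ℤ
∏-minus-∈ {e ∷ bs} (here refl) = cong (_* ∏-minus bs e) (ℤP.+-inverseʳ e)
∏-minus-∈ {b ∷ bs} {e} (there e∈bs) = trans (cong ((e - b) *_) (∏-minus-∈ e∈bs)) (ℤP.*-zeroʳ (e - b))

∏-minus-∉ : ∀ {bs e} → All (e ≢_) bs → ∏-minus bs e ≢ 0ℤ
∏-minus-∉ {b ∷ bs} {e} (e≢b ∷ e∉bs) ∏≡0 with ℤP.i*j≡0⇒i≡0∨j≡0 (e - b) ∏≡0
... | inj₁ e-b≡0 = e≢b (ℤP.i-j≡0⇒i≡j e b e-b≡0)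
... | inj₂ ∏′≡0  = ∏-minus-∉ e∉bs ∏′≡0

module _ {M half} (C : Character M half) where
  open Character C

  ∑<-progression : ∀ j u → ∑< M (λ x → χ (u + + x * j)) ≡ + M * (indicator (+ M ∣? j) * χ u)
  ∑<-progression j u with + M ∣? j
  ... | yes (divides z refl) = begin
      ∑< M (λ x → χ (u + + x * (z * + M)))
        ≡⟨ ∑<-cong M (λ x → trans (cong (λ w → χ (u + w)) (sym (ℤP.*-assoc (+ x) z (+ M))))
                                  (Periodicity.periodic-+* M periodic u (+ x * z))) ⟩
      ∑< M (λ _ → χ u)                         ≡⟨ ∑<-const M (χ u) ⟩
      + M * χ u                                ≡⟨ cong (+ M *_) (sym (ℤP.*-identityˡ (χ u))) ⟩
      + M * (1ℤ * χ u)                         ∎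
    where open ≡-Reasoning
  ... | no M∤j = trans (progression-∑≡0 M∤j u) (sym (ℤP.*-zeroʳ (+ M)))

module PolynomialMethod {M : ℕ} {P : ℤ} (C : Character M P) (M≢0 : M ≢ 0)
  {k : ℕ} (m : ℕ) (a μ : Fin k → ℤ)
  (cover : ∀ x (T : Subset k) → ∣ T ∣ < m → ∃ λ s → lookup T s ≡ outside × + M ∣ (a s - x) * μ s)
  (β : ℤ) where

  open Character C

  weight : Subset k → ℤ
  weight I = sumIn I μ

  ScaledAdmissible : Subset k → Set
  ScaledAdmissible I = + M ∣ β - weight I

  scaledAdmissible? : ∀ I → Dec (ScaledAdmissible I)
  scaledAdmissible? I = + M ∣? β - weight I

  aμ : Fin k → ℤ
  aμ s = a s * μ s

  scaledValue : Subset k → ℤ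
  scaledValue I = sumIn I (λ s → aμ s - P)

  term : ℤ → Subset k → ℤ
  term t I = sign I * (indicator (scaledAdmissible? I) * χ (t + sumIn I aμ))

  term-admissible : ∀ t I → ScaledAdmissible I → term t I ≡ χ (t + scaledValue I)
  term-admissible t I adm = begin
      sign I * (indicator (scaledAdmissible? I) * χ (t + sumIn I aμ))
        ≡⟨ cong (λ i → sign I * (i * χ (t + sumIn I aμ))) (indicator-yes (scaledAdmissible? I) adm) ⟩
      sign I * (1ℤ * χ (t + sumIn I aμ))
        ≡⟨ cong (sign I *_) (ℤP.*-identityˡ _) ⟩
      sign I * χ (t + sumIn I aμ)
        ≡⟨ cong (λ u → sign I * χ (t + u)) sumIn-aμ ⟩
      sign I * χ (t + (scaledValue I + + ∣ I ∣ * P))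
        ≡⟨ cong (λ u → sign I * χ u) (sym (ℤP.+-assoc t (scaledValue I) _)) ⟩
      sign I * χ (t + scaledValue I + + ∣ I ∣ * P)
        ≡⟨ sign-antiperiodic χ P antiperiodic I (t + scaledValue I) ⟩
      χ (t + scaledValue I) ∎
    where
    open ≡-Reasoning
    sumIn-aμ : sumIn I aμ ≡ scaledValue I + + ∣ I ∣ * P
    sumIn-aμ = begin
      sumIn I aμ
        ≡⟨ lem (sumIn I aμ) (+ ∣ I ∣ * P) ⟩
      sumIn I aμ - + ∣ I ∣ * P + + ∣ I ∣ * P
        ≡⟨ cong (λ u → sumIn I aμ - u + + ∣ I ∣ * P) (sym (sumIn-const I P)) ⟩
      sumIn I aμ - sumIn I (λ _ → P) + + ∣ I ∣ * P
        ≡⟨ cong (_+ + ∣ I ∣ * P) (sym (sumIn-distrib-minus I aμ (λ _ → P))) ⟩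
      scaledValue I + + ∣ I ∣ * P ∎
      where lem : ∀ x y → x ≡ x - y + y
            lem = solve-∀

  term-inadmissible : ∀ t I → ¬ ScaledAdmissible I → term t I ≡ 0ℤ
  term-inadmissible t I ¬adm =
    trans (cong (λ i → sign I * (i * χ (t + sumIn I aμ))) (indicator-no (scaledAdmissible? I) ¬adm))
          (ℤP.*-zeroʳ (sign I))

  private
    sumIn-aμ-along : ∀ t x I → t + sumIn I aμ + x * (β - weight I) ≡ t + x * β + sumIn I (λ s → (a s - x) * μ s)
    sumIn-aμ-along t x I = begin
        t + sumIn I aμ + x * (β - weight I)                   ≡⟨ lem₁ t (sumIn I aμ) x β (weight I) ⟩
        t + x * β + (sumIn I aμ - x * weight I)
          ≡⟨ cong (λ u → t + x * β + (sumIn I aμ - u)) (sym (sumIn-*ˡ I x μ)) ⟩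
        t + x * β + (sumIn I aμ - sumIn I (λ s → x * μ s))
          ≡⟨ cong (ℤ._+_ (t + x * β)) (sym (sumIn-distrib-minus I aμ _)) ⟩
        t + x * β + sumIn I (λ s → a s * μ s - x * μ s)
          ≡⟨ cong (ℤ._+_ (t + x * β)) (sumIn-cong I (λ s → lem₂ (a s) x (μ s))) ⟩
        t + x * β + sumIn I (λ s → (a s - x) * μ s) ∎
      where open ≡-Reasoning
            lem₁ : ∀ t A x β w → t + A + x * (β - w) ≡ t + x * β + (A - x * w)
            lem₁ = solve-∀
            lem₂ : ∀ a x μ → a * μ - x * μ ≡ (a - x) * μ
            lem₂ = solve-∀

  -- the orthogonality relation turns the admissibility indicator into a sum along a progression,
  -- and along each x the m-cover supplies some s ∉ T that makes the alternating sum vanish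
  sumSupersets-term≡0 : ∀ T → ∣ T ∣ < m → ∀ t → sumSupersets T (term t) ≡ 0ℤ
  sumSupersets-term≡0 T ∣T∣<m t with ℤP.i*j≡0⇒i≡0∨j≡0 (+ M) M*sum≡0
    where
    M*sum≡0 : + M * sumSupersets T (term t) ≡ 0ℤ
    M*sum≡0 = begin
        + M * sumSupersets T (term t)
          ≡⟨ sym (sumSupersets-*ˡ T (+ M) (term t)) ⟩
        sumSupersets T (λ I → + M * term t I)
          ≡⟨ sumSupersets-cong T (λ I → trans (lem (+ M) (sign I) _)
                                              (cong (sign I *_) (sym (∑<-progression C (β - weight I) _)))) ⟩
        sumSupersets T (λ I → sign I * ∑< M (λ x → χ (t + sumIn I aμ + + x * (β - weight I))))
          ≡⟨ sumSupersets-cong T (λ I → sym (∑<-*ˡ M (sign I) _)) ⟩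
        sumSupersets T (λ I → ∑< M (λ x → sign I * χ (t + sumIn I aμ + + x * (β - weight I))))
          ≡⟨ sumSupersets-∑< T M (λ x I → sign I * χ (t + sumIn I aμ + + x * (β - weight I))) ⟩
        ∑< M (λ x → sumSupersets T (λ I → sign I * χ (t + sumIn I aμ + + x * (β - weight I))))
          ≡⟨ ∑<-cong M (λ x → sumSupersets-cong T (λ I → cong (λ u → sign I * χ u) (sumIn-aμ-along t (+ x) I))) ⟩
        ∑< M (λ x → sumSupersets T (λ I → sign I * χ (t + + x * β + sumIn I (λ s → (a s - + x) * μ s))))
          ≡⟨ ∑<-zero M (λ x → let s , s∉T , divides z [a-x]μ≡zM = cover (+ x) T ∣T∣<m in
               sumSupersets-alternating≡0 T χ (λ s → (a s - + x) * μ s) s∉T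
                 (λ y → trans (cong (λ w → χ (y + w)) [a-x]μ≡zM) (Periodicity.periodic-+* M periodic y z)) (t + + x * β)) ⟩
        0ℤ ∎
      where
      open ≡-Reasoning
      lem : ∀ m s u → m * (s * u) ≡ s * (m * u)
      lem = solve-∀
  ... | inj₁ M≡0 = ⊥-elim (M≢0 (ℤP.+-injective M≡0))
  ... | inj₂ sum≡0 = sum≡0

  -- by sumSupersets-*sumIn, each factor e − b of the polynomial costs one more element of T
  sumSupersets-term*∏≡0 : ∀ bs T → ∣ T ∣ ℕ.+ length bs < m → ∀ t →
                          sumSupersets T (λ I → term t I * ∏-minus bs (scaledValue I)) ≡ 0ℤ
  sumSupersets-term*∏≡0 [] T ∣T∣<m t =
    trans (sumSupersets-cong T (λ I → ℤP.*-identityʳ (term t I)))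
          (sumSupersets-term≡0 T (subst (_< m) (ℕP.+-identityʳ ∣ T ∣) ∣T∣<m) t)
  sumSupersets-term*∏≡0 (b ∷ bs) T ∣T∣+1+n<m t = begin
      sumSupersets T (λ I → term t I * ((scaledValue I - b) * ∏-minus bs (scaledValue I)))
        ≡⟨ sumSupersets-cong T (λ I → lem (term t I) (scaledValue I) b (∏-minus bs (scaledValue I))) ⟩
      sumSupersets T (λ I → F I * scaledValue I - b * F I)
        ≡⟨ sumSupersets-distrib-minus T (λ I → F I * scaledValue I) (λ I → b * F I) ⟩
      sumSupersets T (λ I → F I * scaledValue I) - sumSupersets T (λ I → b * F I)
        ≡⟨ cong₂ _-_ (trans (sumSupersets-*sumIn T F d)
                            (sumIn-zero ⊤ (λ s → trans (cong (d s *_) (sumSupersets-term*∏≡0 bs (T [ s ]≔ inside) (bigger s) t))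
                                                       (ℤP.*-zeroʳ (d s)))))
                     (trans (sumSupersets-*ˡ T b F) (trans (cong (b *_) (sumSupersets-term*∏≡0 bs T same t)) (ℤP.*-zeroʳ b))) ⟩
      0ℤ - 0ℤ
        ≡⟨⟩
      0ℤ ∎
    where
    open ≡-Reasoning
    d : Fin k → ℤ
    d s = aμ s - P
    F : Subset k → ℤ
    F I = term t I * ∏-minus bs (scaledValue I)
    lem : ∀ g e b r → g * ((e - b) * r) ≡ g * r * e - b * (g * r)
    lem = solve-∀
    bigger : ∀ s → ∣ T [ s ]≔ inside ∣ ℕ.+ length bs < m
    bigger s = ℕP.<-≤-trans (ℕ.s≤s (ℕP.+-monoˡ-≤ (length bs) (∣[]≔inside∣≤ T s)))
                            (subst (_≤ m) (cong suc (ℕP.+-suc ∣ T ∣ (length bs))) ∣T∣+1+n<m)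
    same : ∣ T ∣ ℕ.+ length bs < m
    same = ℕP.<-trans (ℕP.+-monoʳ-< ∣ T ∣ (ℕP.n<1+n (length bs))) ∣T∣+1+n<m

  module _ {J : Subset k} (J-adm : ScaledAdmissible J) where

    -- at t = − e(J) the polynomial ∏ (e − b) over the other values b leaves, for each admissible I,
    -- either 0 or the common nonzero value χ(0) ∏ (e(J) − b)
    fewValues⇒⊥ : ∀ bs → length bs < m → All (scaledValue J ≢_) bs →
                  (∀ I → ScaledAdmissible I → scaledValue I ≡ scaledValue J ⊎ scaledValue I ∈ bs) → Empty
    fewValues⇒⊥ bs ∣bs∣<m eJ∉bs covered =
      c≢0 (ℤP.*-cancelˡ-≡ (+ suc N) c 0ℤ (trans (sym sum≡[1+N]c) (trans sum≡0 (sym (ℤP.*-zeroʳ (+ suc N))))))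
      where
      e₀ = scaledValue J
      t = - e₀
      F : Subset k → ℤ
      F I = term t I * ∏-minus bs (scaledValue I)
      c = χ 0ℤ * ∏-minus bs e₀
      c≢0 : c ≢ 0ℤ
      c≢0 c≡0 with ℤP.i*j≡0⇒i≡0∨j≡0 (χ 0ℤ) c≡0
      ... | inj₁ χ0≡0 = χ-0≢0 χ0≡0
      ... | inj₂ ∏≡0  = ∏-minus-∉ eJ∉bs ∏≡0
      F≡c : ∀ I → ScaledAdmissible I → scaledValue I ≡ e₀ → F I ≡ c
      F≡c I adm e≡e₀ = begin
          term t I * ∏-minus bs (scaledValue I)         ≡⟨ cong (_* ∏-minus bs (scaledValue I)) (term-admissible t I adm) ⟩
          χ (t + scaledValue I) * ∏-minus bs (scaledValue I) ≡⟨ cong (λ e → χ (t + e) * ∏-minus bs e) e≡e₀ ⟩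
          χ (- e₀ + e₀) * ∏-minus bs e₀                 ≡⟨ cong (λ u → χ u * ∏-minus bs e₀) (ℤP.+-inverseˡ e₀) ⟩
          c                                             ∎
        where open ≡-Reasoning
      F∈0c : ∀ I → F I ≡ 0ℤ ⊎ F I ≡ c
      F∈0c I = by-admissibility (scaledAdmissible? I)
        where
        by-admissibility : Dec (ScaledAdmissible I) → F I ≡ 0ℤ ⊎ F I ≡ c
        by-admissibility (no ¬adm) = inj₁ (cong (_* ∏-minus bs (scaledValue I)) (term-inadmissible t I ¬adm))
        by-admissibility (yes adm) with covered I adm
        ... | inj₁ e≡e₀ = inj₂ (F≡c I adm e≡e₀)
        ... | inj₂ e∈bs = inj₁ (trans (cong (term t I *_) (∏-minus-∈ e∈bs)) (ℤP.*-zeroʳ (term t I)))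
      sum≡0 : sumSupersets ⊥ F ≡ 0ℤ
      sum≡0 = sumSupersets-term*∏≡0 bs ⊥ (subst (λ n → n ℕ.+ length bs < m) (sym (∣⊥∣≡0 k)) ∣bs∣<m) t
      N = proj₁ (sumAll-0∨C-∋C F c F∈0c J (F≡c J J-adm refl))
      sum≡[1+N]c = proj₂ (sumAll-0∨C-∋C F c F∈0c J (F≡c J J-adm refl))

    otherValues-length≥m : ∀ bs → All (scaledValue J ≢_) bs →
                           (∀ I → ScaledAdmissible I → scaledValue I ≡ scaledValue J ⊎ scaledValue I ∈ bs) → m ≤ length bs
    otherValues-length≥m bs eJ∉bs covered with m ℕP.≤? length bs
    ... | yes m≤∣bs∣ = m≤∣bs∣
    ... | no  m≰∣bs∣ = ⊥-elim (fewValues⇒⊥ bs (ℕP.≰⇒> m≰∣bs∣) eJ∉bs covered)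

    admissibleValues-length>m : ∀ vs → (∀ I → ScaledAdmissible I → scaledValue I ∈ vs) → m < length vs
    admissibleValues-length>m vs covered =
      ℕP.≤-<-trans (otherValues-length≥m (filter ≢e₀? vs) (all-filter ≢e₀? vs) covered-by-others)
                   (LP.filter-notAll ≢e₀? vs (Any.map (λ e₀≡v e₀≢v → e₀≢v e₀≡v) (covered J J-adm)))
      where
      e₀ = scaledValue J
      ≢e₀? = λ b → ¬? (e₀ ℤ.≟ b)
      covered-by-others : ∀ I → ScaledAdmissible I → scaledValue I ≡ e₀ ⊎ scaledValue I ∈ filter ≢e₀? vs
      covered-by-others I adm with e₀ ℤ.≟ scaledValue I
      ... | yes e₀≡e = inj₁ (sym e₀≡e)
      ... | no  e₀≢e = inj₂ (∈-filter⁺ ≢e₀? (covered I adm) e₀≢e)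

-- Back to rationals

private
  filter-∈?-map-suc : ∀ {k} b (I : Subset k) xs →
                      filter (_∈? (b ∷ I)) (map suc xs) ≡ map suc (filter (_∈? I) xs)
  filter-∈?-map-suc b I []       = refl
  filter-∈?-map-suc b I (x ∷ xs) with x ∈? I
  ... | yes _ = cong (suc x ∷_) (filter-∈?-map-suc b I xs)
  ... | no  _ = filter-∈?-map-suc b I xs

  sumOver-∷ : ∀ {k} b (I : Subset k) (f : Fin (suc k) → ℚ) →
              foldr (λ s acc → f s ℚ.+ acc) 0ℚ (filter (_∈? (b ∷ I)) (tabulate suc)) ≡ sumOver I (f ∘ suc)
  sumOver-∷ {k} b I f = begin
      foldr (λ s acc → f s ℚ.+ acc) 0ℚ (filter (_∈? (b ∷ I)) (tabulate suc))
        ≡⟨ cong (foldr (λ s acc → f s ℚ.+ acc) 0ℚ ∘ filter (_∈? (b ∷ I))) (sym (LP.map-tabulate (λ s → s) suc)) ⟩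
      foldr (λ s acc → f s ℚ.+ acc) 0ℚ (filter (_∈? (b ∷ I)) (map suc (allFin k)))
        ≡⟨ cong (foldr (λ s acc → f s ℚ.+ acc) 0ℚ) (filter-∈?-map-suc b I (allFin k)) ⟩
      foldr (λ s acc → f s ℚ.+ acc) 0ℚ (map suc (filter (_∈? I) (allFin k)))
        ≡⟨ LP.foldr-map (λ s acc → f s ℚ.+ acc) suc 0ℚ (filter (_∈? I) (allFin k)) ⟩
      sumOver I (f ∘ suc) ∎
    where open ≡-Reasoning

sumOver-inside : ∀ {k} (I : Subset k) (f : Fin (suc k) → ℚ) → sumOver (inside ∷ I) f ≡ f zero ℚ.+ sumOver I (f ∘ suc)
sumOver-inside I f = cong (f zero ℚ.+_) (sumOver-∷ inside I f)

sumOver-outside : ∀ {k} (I : Subset k) (f : Fin (suc k) → ℚ) → sumOver (outside ∷ I) f ≡ sumOver I (f ∘ suc)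
sumOver-outside I f = sumOver-∷ outside I f

module Scaling (M-1 : ℕ) where

  scaled : ℤ → ℚᵘ
  scaled x = mkℚᵘ x M-1

  scaled-+ : ∀ x y → scaled x ℚᵘ.+ scaled y ≃ scaled (x + y)
  scaled-+ x y = *≡* (trans (lem x y (+ suc M-1)) (cong ((x + y) *_) (sym (ℤP.pos-* (suc M-1) (suc M-1)))))
    where lem : ∀ x y m → (x * m + y * m) * m ≡ (x + y) * (m * m)
          lem = solve-∀

  scaled-injective : ∀ {x y} → scaled x ≃ scaled y → x ≡ y
  scaled-injective {x} {y} (*≡* eq) = ℤP.*-cancelʳ-≡ x y (+ suc M-1) eq

  toℚᵘ-/ : ∀ z d w → z * + suc M-1 ≡ w * + suc d → toℚᵘ (z / suc d) ≃ scaled w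
  toℚᵘ-/ z d w eq = ℚᵘP.≃-trans (ℚP.toℚᵘ-fromℚᵘ (mkℚᵘ z d)) (*≡* eq)

  toℚᵘ-minus : ∀ p q x y → toℚᵘ p ≃ scaled x → toℚᵘ q ≃ scaled y → toℚᵘ (p ℚ.- q) ≃ scaled (x - y)
  toℚᵘ-minus p q x y p≃x q≃y =
    ℚᵘP.≃-trans (ℚP.toℚᵘ-homo-+ p (ℚ.- q))
      (ℚᵘP.≃-trans (ℚᵘP.+-cong p≃x (ℚᵘP.≃-trans (ℚP.toℚᵘ-homo‿- q) (ℚᵘP.-‿cong q≃y))) (scaled-+ x (- y)))

  toℚᵘ-sumOver : ∀ {k} (I : Subset k) (f : Fin k → ℚ) (g : Fin k → ℤ) →
                 (∀ s → toℚᵘ (f s) ≃ scaled (g s)) → toℚᵘ (sumOver I f) ≃ scaled (sumIn I g)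
  toℚᵘ-sumOver []            f g f≃g = *≡* refl
  toℚᵘ-sumOver (inside  ∷ I) f g f≃g =
    ℚᵘP.≃-trans (ℚP.toℚᵘ-cong (sumOver-inside I f))
      (ℚᵘP.≃-trans (ℚP.toℚᵘ-homo-+ (f zero) _)
        (ℚᵘP.≃-trans (ℚᵘP.+-cong (f≃g zero) (toℚᵘ-sumOver I (f ∘ suc) (g ∘ suc) (f≃g ∘ suc)))
                     (scaled-+ (g zero) (sumIn I (g ∘ suc)))))
  toℚᵘ-sumOver (outside ∷ I) f g f≃g =
    ℚᵘP.≃-trans (ℚP.toℚᵘ-cong (sumOver-outside I f)) (toℚᵘ-sumOver I (f ∘ suc) (g ∘ suc) (f≃g ∘ suc))

module ScaledSetting {k m : ℕ} (a : Fin k → ℤ) (n : Fin k → ℕ) (n>0 : ∀ s → 0 < n s) (a-cover : IsMCover m a n)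
                     (ms : Fin k → ℤ) (J : Subset k) (P-1 : ℕ) (P≡∏n : suc P-1 ≡ product (tabulate n)) where

  P M : ℕ
  P = suc P-1
  M = P ℕ.+ P

  M≢0 : M ≢ 0
  M≢0 ()

  cofactor : Fin k → ℕ
  cofactor s = ℕD._∣_.quotient (∈⇒∣product {ns = tabulate n} (∈-tabulate⁺ s))

  P≡cofactor*n : ∀ s → P ≡ cofactor s ℕ.* n s
  P≡cofactor*n s = trans P≡∏n (ℕD._∣_.equality (∈⇒∣product {ns = tabulate n} (∈-tabulate⁺ s)))

  μ : Fin k → ℤ
  μ s = ms s * + (cofactor s ℕ.+ cofactor s)

  M≡[c+c]*d : ∀ c d → P ≡ c ℕ.* d → + M ≡ + (c ℕ.+ c) * + d
  M≡[c+c]*d c d P≡cd = begin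
    + M                          ≡⟨ cong₂ (λ u v → + (u ℕ.+ v)) P≡cd P≡cd ⟩
    + (c ℕ.* d ℕ.+ c ℕ.* d)      ≡⟨ cong +_ (sym (ℕP.*-distribʳ-+ d c c)) ⟩
    + ((c ℕ.+ c) ℕ.* d)          ≡⟨ ℤP.pos-* (c ℕ.+ c) d ⟩
    + (c ℕ.+ c) * + d            ∎
    where open ≡-Reasoning

  μ-cover : ∀ x (T : Subset k) → ∣ T ∣ < m → ∃ λ s → lookup T s ≡ outside × + M ∣ (a s - x) * μ s
  μ-cover x T ∣T∣<m with pigeonhole-∉ (λ s → x ∈RC? a s , n s) T (ℕP.<-≤-trans ∣T∣<m (a-cover x))
  ... | s , s∉T , x∈a[n] with ∣ᵤ⇒∣ {+ n s} {x - a s} x∈a[n]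
  ...   | divides z x-a≡zn = s , s∉T , divides (- z * ms s) (begin
      (a s - x) * (ms s * + 2c)         ≡⟨ cong (λ u → u * (ms s * + 2c)) (trans (lem₁ (a s) x) (cong -_ x-a≡zn)) ⟩
      - (z * + n s) * (ms s * + 2c)     ≡⟨ lem₂ z (+ n s) (ms s) (+ 2c) ⟩
      - z * ms s * (+ 2c * + n s)       ≡⟨ cong (- z * ms s *_) (sym (M≡[c+c]*d (cofactor s) (n s) (P≡cofactor*n s))) ⟩
      - z * ms s * + M                  ∎)
    where open ≡-Reasoning
          2c = cofactor s ℕ.+ cofactor s
          lem₁ : ∀ a x → a - x ≡ - (x - a)
          lem₁ = solve-∀
          lem₂ : ∀ z n m w → - (z * n) * (m * w) ≡ - z * m * (w * n)
          lem₂ = solve-∀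

  open PolynomialMethod (evenCharacter P) M≢0 m a μ μ-cover (sumIn J μ) public
  open Scaling (P-1 ℕ.+ P)

  toℚᵘ-frac : ∀ z c d → 0 < d → P ≡ c ℕ.* d → toℚᵘ (frac z d) ≃ scaled (z * + (c ℕ.+ c))
  toℚᵘ-frac z c (suc d-1) _ P≡cd =
    toℚᵘ-/ z d-1 _ (trans (cong (z *_) (M≡[c+c]*d c (suc d-1) P≡cd)) (sym (ℤP.*-assoc z (+ (c ℕ.+ c)) (+ suc d-1))))

  toℚᵘ-frac-ms : ∀ s → toℚᵘ (frac (ms s) (n s)) ≃ scaled (μ s)
  toℚᵘ-frac-ms s = toℚᵘ-frac (ms s) (cofactor s) (n s) (n>0 s) (P≡cofactor*n s)

  toℚᵘ-frac-a*ms : ∀ s → toℚᵘ (frac (a s * ms s) (n s)) ≃ scaled (a s * μ s)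
  toℚᵘ-frac-a*ms s = ℚᵘP.≃-trans (toℚᵘ-frac (a s * ms s) (cofactor s) (n s) (n>0 s) (P≡cofactor*n s))
                                (ℚᵘP.≃-reflexive (cong scaled (ℤP.*-assoc (a s) (ms s) _)))

  toℚᵘ-value : ∀ I → toℚᵘ (value a n ms I) ≃ scaled (scaledValue I)
  toℚᵘ-value I =
    ℚᵘP.≃-trans (toℚᵘ-minus _ _ (sumIn I aμ) (+ ∣ I ∣ * + P) (toℚᵘ-sumOver I _ aμ toℚᵘ-frac-a*ms) half)
                (ℚᵘP.≃-reflexive (cong scaled (trans (cong (ℤ._-_ (sumIn I aμ)) (sym (sumIn-const I (+ P))))
                                                     (sym (sumIn-distrib-minus I aμ (λ _ → + P))))))
    where
    half : toℚᵘ (+ ∣ I ∣ / 2) ≃ scaled (+ ∣ I ∣ * + P)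
    half = toℚᵘ-/ (+ ∣ I ∣) 1 _ (trans (cong (+ ∣ I ∣ *_) (ℤP.pos-+ P P)) (lem (+ ∣ I ∣) (+ P)))
      where lem : ∀ x p → x * (p + p) ≡ x * p * + 2
            lem = solve-∀

  value-injective : ∀ I I′ → value a n ms I ≡ value a n ms I′ → scaledValue I ≡ scaledValue I′
  value-injective I I′ eq =
    scaled-injective (ℚᵘP.≃-trans (ℚᵘP.≃-sym (toℚᵘ-value I))
                                  (ℚᵘP.≃-trans (ℚP.toℚᵘ-cong eq) (toℚᵘ-value I′)))

  scaledAdmissible⇒admissible : ∀ I → ScaledAdmissible I → Admissible n ms J I
  scaledAdmissible⇒admissible I (divides z β-w≡zM) =
    - z , trans (sym (ℚP.fromℚᵘ-toℚᵘ D)) (ℚP.fromℚᵘ-cong D≃-z)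
    where
    D = sumOver I (λ s → frac (ms s) (n s)) ℚ.- sumOver J (λ s → frac (ms s) (n s))
    w-β≡-zM : weight I - sumIn J μ ≡ - z * + M
    w-β≡-zM = trans (lem (weight I) (sumIn J μ)) (trans (cong -_ β-w≡zM) (ℤP.neg-distribˡ-* z (+ M)))
      where lem : ∀ w b → w - b ≡ - (b - w)
            lem = solve-∀
    D≃-z : toℚᵘ D ≃ mkℚᵘ (- z) 0
    D≃-z = ℚᵘP.≃-trans (toℚᵘ-minus _ _ (weight I) (sumIn J μ)
                                   (toℚᵘ-sumOver I _ μ toℚᵘ-frac-ms) (toℚᵘ-sumOver J _ μ toℚᵘ-frac-ms))
                       (ℚᵘP.≃-trans (ℚᵘP.≃-reflexive (cong scaled w-β≡-zM)) (*≡* (ℤP.*-identityʳ (- z * + M))))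

  candidates values : List ℤ
  candidates = map scaledValue (filter scaledAdmissible? (allSubsets k))
  values     = deduplicate ℤ._≟_ candidates

  ∈-values : ∀ I → ScaledAdmissible I → scaledValue I ∈ values
  ∈-values I adm = ∈-deduplicate⁺ ℤ._≟_ (∈-map⁺ scaledValue (∈-filter⁺ scaledAdmissible? (∈-allSubsets I) adm))

  values-realised : ∀ {v} → v ∈ values → ∃ λ I → ScaledAdmissible I × v ≡ scaledValue I
  values-realised v∈ with ∈-map⁻ scaledValue (∈-deduplicate⁻ ℤ._≟_ candidates v∈)
  ... | I , I∈ , v≡ = I , proj₂ (∈-filter⁻ scaledAdmissible? {xs = allSubsets k} I∈) , v≡

  m<∣values∣ : m < length values
  m<∣values∣ = admissibleValues-length>m {J} (divides 0ℤ (ℤP.+-inverseʳ (sumIn J μ))) values ∈-values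

corollary3p2 : (k m : ℕ) (a : Fin k → ℤ) (n : Fin k → ℕ) → (∀ s → 0 < n s) → IsMCover m a n →
    (ms : Fin k → ℤ) (J : Subset k) →
    ∃ λ (v : Fin (suc m) → ℚ) → Injective _≡_ _≡_ v ×
      (∀ i → ∃ λ (I : Subset k) → Admissible n ms J I × v i ≡ value a n ms I)
corollary3p2 k m a n n>0 a-cover ms J =
  v , v-injective , λ i → witness i , scaledAdmissible⇒admissible (witness i) (proj₁ (proj₂ (realised i))) , refl
  where
  ∏n = product (tabulate n)
  instance
    ∏n≢0 : NonZero ∏n
    ∏n≢0 = product≢0 (tabulate⁺ (ℕ.>-nonZero ∘ n>0))
  open ScaledSetting a n n>0 a-cover ms J (ℕ.pred ∏n) (ℕP.suc-pred ∏n)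
  index : Fin (suc m) → Fin (length values)
  index i = Fin.inject≤ i m<∣values∣
  realised : ∀ i → ∃ λ I → ScaledAdmissible I × List.lookup values (index i) ≡ scaledValue I
  realised i = values-realised (∈-lookup (index i))
  witness : Fin (suc m) → Subset k
  witness i = proj₁ (realised i)
  v : Fin (suc m) → ℚ
  v i = value a n ms (witness i)
  v-injective : Injective _≡_ _≡_ v
  v-injective {i} {j} vi≡vj = FinP.inject≤-injective m<∣values∣ m<∣values∣ i j
    (Unique-lookup-injective (deduplicate-! candidates) (index i) (index j)
      (trans (proj₂ (proj₂ (realised i)))
             (trans (value-injective (witness i) (witness j) vi≡vj) (sym (proj₂ (proj₂ (realised j)))))))
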